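{- Let $\lambda$ be a partition and $i$ a column index with $\lambda'_i=\lambda'_{i+1}=:h$, let $1\le r\le h$, let $\sigma\in\mathcal{T}(\lambda)$, and let $S\in\{S_1,\dots,S_8\}$. Then $$\mathrm{maj}(\sigma)-\mathrm{maj}(\delta_i^r(\sigma))=D_r(\sigma)-D_r(\delta_i^r(\sigma)),\qquad \eta_S(\sigma)-\eta_S(\delta_i^r(\sigma))=E_r(\sigma)-E_r(\delta_i^r(\sigma));$$ that is, for every $s\ne r$ one has $D_s(\sigma)=D_s(\delta_i^r(\sigma))$ and $E_s(\sigma)=E_s(\delta_i^r(\sigma))$.
   Context: French Young diagram of $\lambda$ with cells $(r,c)$ (row $r$ from the bottom, column $c$ from the left), $\lambda'_c$ = height of column $c$. A filling $\sigma\in\mathcal{T}(\lambda)$ assigns positive integers to cells; convention $\sigma(\lambda'_c+1,c)=0$. A cell $(s+1,c)$ with $s+1\le\lambda'_c$ is a descent if $\sigma(s+1,c)>\sigma(s,c)$; $\mathrm{maj}(\sigma)=\sum_{\text{descents }(s+1,c)}(\lambda'_c-s)$. For $s\ge1$ let $D_s(\sigma)=\sum(\lambda'_c-s)$ over the descents $(s+1,c)$ located in row $s+1$ (the contribution of row $s+1$ to $\mathrm{maj}$). Pattern sets: $S^*$ = chains $z=w>v>u$, $u\ge z=w>v$, $v>u\ge z=w$. Each $S_i$ consists of $S^*$, the chains $z>v\ge w>u$, $u\ge z>v\ge w$ and four more: $S_1$: $z>w>v>u$, $u>v\ge z>w$, $z>u>v\ge w$, $v\ge z>w>u$; $S_2$: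 $z>w>v>u$, $v>u\ge z>w$, $z>u>v\ge w$, $v\ge z>w>u$; $S_3$: $z>w>u>v$, $u>v\ge z>w$, $z>u>v\ge w$, $v\ge z>w>u$; $S_4$: $z>w>u>v$, $v>u\ge z>w$, $z>u>v\ge w$, $v\ge z>w>u$; $S_5$: $z>w>v>u$, $u>v\ge z>w$, $z>v>u\ge w$, $u\ge z>w>v$; $S_6$: $z>w>u>v$, $u>v\ge z>w$, $z>v>u\ge w$, $u\ge z>w>v$; $S_7$: $z>w>v>u$, $v>u\ge z>w$, $z>v>u\ge w$, $u\ge z>w>v$; $S_8$: $z>w>u>v$, $v>u\ge z>w$, $z>v>u\ge w$, $u\ge z>w>v$. $Q_S(z,w,u,v)=1$ iff $(z,w,u,v)$ satisfies a chain of $S^*$, or one of the six further chains of $S$, or $(w,z,v,u)$ satisfies one of those six chains; else $0$. For $s\ge 1$, $E_s(\sigma)$ is the number of 4-tuples of cells $(s+1,c),(s+1,d),(s,c),(s,d)$ with $c<d$, $\lambda'_c=\lambda'_d\ge s$ and $Q_S(\sigma(s+1,c),\sigma(s+1,d),\sigma(s,c),\sigma(s,d))=1$; $\eta_S(\sigma)=\sum_{s\ge1}E_s(\sigma)$. Operator $\delta_i^r$: let $k$ be the largest integer with $1\le k\le r$ and $\sigma(k,i)=\sigma(k,i+1)$, and $k=1$ if there is none; $\delta_i^r(\sigma)$ is obtained from $\sigma$ by exchanging $\sigma(x,i)$ and $\sigma(x,i+1)$ for all $k\le x\le r$. -}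

module Defs where

open import Data.Nat using (ℕ; zero; suc; _+_; _*_; _∸_; _≤_; _<ᵇ_; _≡ᵇ_)
open import Data.Bool using (Bool; true; false; _∧_; _∨_; not; if_then_else_)
open import Data.List using (List; []; _∷_; length; map; upTo)
open import Data.Nat.ListAction using (sum)

-- Partitions (given by their row lengths λ₁ ≥ λ₂ ≥ … > 0, rows numbered
-- from 1 at the bottom, French convention) and their conjugates.

data IsPartition : List ℕ → Set where
  nil  : IsPartition []
  one  : ∀ {a} → 1 ≤ a → IsPartition (a ∷ [])
  cons : ∀ {a b l} → b ≤ a → IsPartition (b ∷ l) → IsPartition (a ∷ b ∷ l)

-- λ'_c : height of column c (columns numbered from 1)
conj : List ℕ → ℕ → ℕ
conj [] c = 0
conj (a ∷ l) c = (if a <ᵇ c then 0 else 1) + conj l c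

ncols : List ℕ → ℕ
ncols [] = 0
ncols (a ∷ _) = a

nrows : List ℕ → ℕ
nrows = length

_>ᵇ_ : ℕ → ℕ → Bool
a >ᵇ b = b <ᵇ a

_≥ᵇ_ : ℕ → ℕ → Bool
a ≥ᵇ b = not (a <ᵇ b)

inCell : List ℕ → ℕ → ℕ → Bool
inCell la r c = (r ≥ᵇ 1) ∧ (c ≥ᵇ 1) ∧ (conj la c ≥ᵇ r)

-- Fillings: a filling is a function (row, column) ↦ value; only its
-- values on cells matter, and those must be positive.

Filling : Set
Filling = ℕ → ℕ → ℕ

IsFilling : List ℕ → Filling → Set
IsFilling la σ = ∀ r c → inCell la r c ≡ true → 1 ≤ σ r c
  where open import Relation.Binary.PropositionalEquality using (_≡_)

-- value with the convention: 0 outside the diagram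
-- (in particular σ(λ'_c + 1, c) = 0)
val : List ℕ → Filling → ℕ → ℕ → ℕ
val la σ r c = if inCell la r c then σ r c else 0

Σ[1‥_] : ℕ → (ℕ → ℕ) → ℕ
Σ[1‥ n ] f = sum (map (λ k → f (suc k)) (upTo n))

[_] : Bool → ℕ
[ true ] = 1
[ false ] = 0

D : List ℕ → ℕ → Filling → ℕ
D la s σ = Σ[1‥ ncols la ] (λ c →
  [ (conj la c ≥ᵇ suc s) ∧ (val la σ (suc s) c >ᵇ val la σ s c) ]
    * (conj la c ∸ s))

maj : List ℕ → Filling → ℕ
maj la σ = Σ[1‥ nrows la ] (λ s → D la s σ)

data PatSet : Set where
  S1 S2 S3 S4 S5 S6 S7 S8 : PatSet

star : ℕ → ℕ → ℕ → ℕ → Bool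
star z w u v =
     ((z ≡ᵇ w) ∧ (w >ᵇ v) ∧ (v >ᵇ u))
  ∨ ((u ≥ᵇ z) ∧ (z ≡ᵇ w) ∧ (w >ᵇ v))
  ∨ ((v >ᵇ u) ∧ (u ≥ᵇ z) ∧ (z ≡ᵇ w))

common : ℕ → ℕ → ℕ → ℕ → Bool
common z w u v =
     ((z >ᵇ v) ∧ (v ≥ᵇ w) ∧ (w >ᵇ u))
  ∨ ((u ≥ᵇ z) ∧ (z >ᵇ v) ∧ (v ≥ᵇ w))

a1 a2 b1 b2 c1 c2 d1 d2 : ℕ → ℕ → ℕ → ℕ → Bool
a1 z w u v = (z >ᵇ w) ∧ (w >ᵇ v) ∧ (v >ᵇ u)
a2 z w u v = (z >ᵇ w) ∧ (w >ᵇ u) ∧ (u >ᵇ v)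
b1 z w u v = (u >ᵇ v) ∧ (v ≥ᵇ z) ∧ (z >ᵇ w)
b2 z w u v = (v >ᵇ u) ∧ (u ≥ᵇ z) ∧ (z >ᵇ w)
c1 z w u v = (z >ᵇ u) ∧ (u >ᵇ v) ∧ (v ≥ᵇ w)
c2 z w u v = (z >ᵇ v) ∧ (v >ᵇ u) ∧ (u ≥ᵇ w)
d1 z w u v = (v ≥ᵇ z) ∧ (z >ᵇ w) ∧ (w >ᵇ u)
d2 z w u v = (u ≥ᵇ z) ∧ (z >ᵇ w) ∧ (w >ᵇ v)

specific : PatSet → ℕ → ℕ → ℕ → ℕ → Bool
specific S1 z w u v = a1 z w u v ∨ b1 z w u v ∨ c1 z w u v ∨ d1 z w u v
specific S2 z w u v = a1 z w u v ∨ b2 z w u v ∨ c1 z w u v ∨ d1 z w u v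
specific S3 z w u v = a2 z w u v ∨ b1 z w u v ∨ c1 z w u v ∨ d1 z w u v
specific S4 z w u v = a2 z w u v ∨ b2 z w u v ∨ c1 z w u v ∨ d1 z w u v
specific S5 z w u v = a1 z w u v ∨ b1 z w u v ∨ c2 z w u v ∨ d2 z w u v
specific S6 z w u v = a2 z w u v ∨ b1 z w u v ∨ c2 z w u v ∨ d2 z w u v
specific S7 z w u v = a1 z w u v ∨ b2 z w u v ∨ c2 z w u v ∨ d2 z w u v
specific S8 z w u v = a2 z w u v ∨ b2 z w u v ∨ c2 z w u v ∨ d2 z w u v

six : PatSet → ℕ → ℕ → ℕ → ℕ → Bool
six S z w u v = common z w u v ∨ specific S z w u v

Q : PatSet → ℕ → ℕ → ℕ → ℕ → Bool
Q S z w u v = star z w u v ∨ six S z w u v ∨ six S w z v u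

E : PatSet → List ℕ → ℕ → Filling → ℕ
E S la s σ = Σ[1‥ ncols la ] (λ d → Σ[1‥ d ∸ 1 ] (λ c →
  [ (conj la c ≡ᵇ conj la d) ∧ (conj la c ≥ᵇ s)
    ∧ Q S (val la σ (suc s) c) (val la σ (suc s) d) (val la σ s c) (val la σ s d) ]))

η : PatSet → List ℕ → Filling → ℕ
η S la σ = Σ[1‥ nrows la ] (λ s → E S la s σ)

-- largest k with 1 ≤ k ≤ r and σ(k,i) = σ(k,i+1); 1 if none
findK : Filling → ℕ → ℕ → ℕ
findK σ i zero = 1
findK σ i (suc k) = if σ (suc k) i ≡ᵇ σ (suc k) (suc i) then suc k else findK σ i k

δ : ℕ → ℕ → Filling → Filling
δ i r σ x c =
  if (findK σ i r ≤ᵇ' x) ∧ (x ≤ᵇ' r)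
  then (if c ≡ᵇ i then σ x (suc i) else if c ≡ᵇ suc i then σ x i else σ x c)
  else σ x c
  where
  _≤ᵇ'_ : ℕ → ℕ → Bool
  a ≤ᵇ' b = not (b <ᵇ a)

-- The statistics D_s and E_s only read rows s and s + 1 of a filling.  The
-- operator δ_i^r changes only rows k, …, r (k = findK), where it exchanges the
-- two columns i, i + 1 of equal height h.  For s + 1 < k or s > r neither row
-- changes; for s + 1 = k ≥ 2 row k is left fixed because σ(k,i) = σ(k,i+1).
-- For k ≤ s < r both rows are transposed: D_s is a sum over single columns and
-- does not see the transposition, and in E_s the transposition only exchanges
-- the roles of c and d in the pair {i, i+1}, on which Q_S is symmetric because
-- σ(s+1,i) ≠ σ(s+1,i+1) by maximality of k.
module Submission where

open import Defs
open import Data.Nat using (ℕ; zero; suc; _+_; _*_; _∸_; _≤_; _<_; _<ᵇ_; _≡ᵇ_; z≤n; s≤s)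
open import Data.Nat.Properties
open import Data.Nat.ListAction using (sum)
open import Data.Nat.ListAction.Properties using (sum-++)
open import Data.Bool using (Bool; T; true; false; _∧_; not; if_then_else_)
open import Data.Bool.Properties using (∨-comm; ∧-zeroʳ; if-float; if-cong-else)
open import Data.List using (List; []; _∷_; _∷ʳ_; _++_; map; upTo)
open import Data.List.Properties using (upTo-∷ʳ; map-++)
open import Data.Product using (_×_; _,_; proj₁; proj₂; zip′)
open import Data.Sum using (inj₁; inj₂)
open import Data.Empty using (⊥-elim)
open import Function using (_∘_)
open import Relation.Nullary using (yes; no; contradiction)
open import Relation.Binary using (tri<; tri≈; tri>)
open import Relation.Binary.PropositionalEquality hiding ([_])
open import Algebra.Properties.CommutativeSemigroup +-commutativeSemigroup
  using (xy∙z≈xz∙y; x∙yz≈y∙xz)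

open ≡-Reasoning

≡ᵇ-refl : ∀ a → (a ≡ᵇ a) ≡ true
≡ᵇ-refl zero = refl
≡ᵇ-refl (suc a) = ≡ᵇ-refl a

≡ᵇ-false : ∀ {a b} → a ≢ b → (a ≡ᵇ b) ≡ false
≡ᵇ-false {a} {b} a≢b with a ≡ᵇ b in eq
... | false = refl
... | true = ⊥-elim (a≢b (≡ᵇ⇒≡ a b (subst T (sym eq) _)))

<ᵇ-true : ∀ {a b} → a < b → (a <ᵇ b) ≡ true
<ᵇ-true {zero} (s≤s _) = refl
<ᵇ-true {suc a} (s≤s a<b) = <ᵇ-true a<b

<ᵇ-false : ∀ {a b} → b ≤ a → (a <ᵇ b) ≡ false
<ᵇ-false z≤n = refl
<ᵇ-false (s≤s b≤a) = <ᵇ-false b≤a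

Σ-suc : ∀ n (f : ℕ → ℕ) → Σ[1‥ suc n ] f ≡ Σ[1‥ n ] f + f (suc n)
Σ-suc n f = begin
  sum (map g (upTo (suc n)))         ≡⟨ cong (sum ∘ map g) (upTo-∷ʳ n) ⟨
  sum (map g (upTo n ∷ʳ n))          ≡⟨ cong sum (map-++ g (upTo n) (n ∷ [])) ⟩
  sum (map g (upTo n) ++ (g n ∷ [])) ≡⟨ sum-++ (map g (upTo n)) (g n ∷ []) ⟩
  Σ[1‥ n ] f + (f (suc n) + 0)       ≡⟨ cong (Σ[1‥ n ] f +_) (+-identityʳ (f (suc n))) ⟩
  Σ[1‥ n ] f + f (suc n)             ∎
  where
  g : ℕ → ℕ
  g k = f (suc k)

Σ-cong : ∀ n {f g : ℕ → ℕ} → (∀ k → 1 ≤ k → k ≤ n → f k ≡ g k) → Σ[1‥ n ] f ≡ Σ[1‥ n ] g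
Σ-cong zero f≡g = refl
Σ-cong (suc n) {f} {g} f≡g = begin
  Σ[1‥ suc n ] f         ≡⟨ Σ-suc n f ⟩
  Σ[1‥ n ] f + f (suc n) ≡⟨ cong₂ _+_ (Σ-cong n λ k 1≤k k≤n → f≡g k 1≤k (m≤n⇒m≤1+n k≤n))
                                      (f≡g (suc n) (s≤s z≤n) ≤-refl) ⟩
  Σ[1‥ n ] g + g (suc n) ≡⟨ Σ-suc n g ⟨
  Σ[1‥ suc n ] g         ∎

Σ-agree-except : ∀ n r (f g : ℕ → ℕ) → 1 ≤ r → r ≤ n
  → (∀ s → 1 ≤ s → s ≢ r → f s ≡ g s)
  → Σ[1‥ n ] f + g r ≡ Σ[1‥ n ] g + f r
Σ-agree-except zero (suc _) _ _ _ () _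
Σ-agree-except (suc m) r f g 1≤r r≤n f≡g with m≤n⇒m<n∨m≡n r≤n
... | inj₁ r≤m = begin
  Σ[1‥ suc m ] f + g r          ≡⟨ cong (_+ g r) (Σ-suc m f) ⟩
  Σ[1‥ m ] f + f (suc m) + g r  ≡⟨ xy∙z≈xz∙y (Σ[1‥ m ] f) _ _ ⟩
  Σ[1‥ m ] f + g r + f (suc m)  ≡⟨ cong₂ _+_ (Σ-agree-except m r f g 1≤r (≤-pred r≤m) f≡g)
                                             (f≡g (suc m) (s≤s z≤n) (>⇒≢ r≤m)) ⟩
  Σ[1‥ m ] g + f r + g (suc m)  ≡⟨ xy∙z≈xz∙y (Σ[1‥ m ] g) _ _ ⟩
  Σ[1‥ m ] g + g (suc m) + f r  ≡⟨ cong (_+ f r) (Σ-suc m g) ⟨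
  Σ[1‥ suc m ] g + f r          ∎
... | inj₂ refl = begin
  Σ[1‥ suc m ] f + g r          ≡⟨ cong (_+ g r) (Σ-suc m f) ⟩
  Σ[1‥ m ] f + f r + g r        ≡⟨ cong (λ x → x + f r + g r)
                                     (Σ-cong m λ k 1≤k k≤m → f≡g k 1≤k (<⇒≢ (s≤s k≤m))) ⟩
  Σ[1‥ m ] g + f r + g r        ≡⟨ xy∙z≈xz∙y (Σ[1‥ m ] g) _ _ ⟩
  Σ[1‥ m ] g + g r + f r        ≡⟨ cong (_+ f r) (Σ-suc m g) ⟨
  Σ[1‥ suc m ] g + f r          ∎

transpose : ℕ → ℕ → ℕ
transpose i c = if c ≡ᵇ i then suc i else if c ≡ᵇ suc i then i else c

transpose-i : ∀ i → transpose i i ≡ suc i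
transpose-i i rewrite ≡ᵇ-refl i = refl

transpose-suc-i : ∀ i → transpose i (suc i) ≡ i
transpose-suc-i i rewrite ≡ᵇ-false (1+n≢n {i}) | ≡ᵇ-refl i = refl

transpose-< : ∀ {i c} → c < i → transpose i c ≡ c
transpose-< {i} {c} c<i rewrite ≡ᵇ-false (<⇒≢ c<i) | ≡ᵇ-false (<⇒≢ (m≤n⇒m≤1+n c<i)) = refl

transpose-> : ∀ {i c} → suc i < c → transpose i c ≡ c
transpose-> {i} {c} i+1<c
  rewrite ≡ᵇ-false (>⇒≢ (<-trans (n<1+n i) i+1<c)) | ≡ᵇ-false (>⇒≢ i+1<c) = refl

transpose-invariant : ∀ {A : Set} (φ : ℕ → A) i c → φ i ≡ φ (suc i) → φ (transpose i c) ≡ φ c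
transpose-invariant φ i c φi≡φi+1 with c ≡ᵇ i in eq₁
... | true rewrite ≡ᵇ⇒≡ c i (subst T (sym eq₁) _) = sym φi≡φi+1
... | false with c ≡ᵇ suc i in eq₂
...   | true rewrite ≡ᵇ⇒≡ c (suc i) (subst T (sym eq₂) _) = φi≡φi+1
...   | false = refl

Σ-transpose : ∀ n i (f : ℕ → ℕ) → 1 ≤ i → suc i ≤ n → Σ[1‥ n ] (f ∘ transpose i) ≡ Σ[1‥ n ] f
Σ-transpose (suc m) i f 1≤i i<n with m≤n⇒m<n∨m≡n (≤-pred i<n)
... | inj₁ i<m = begin
  Σ[1‥ suc m ] (f ∘ transpose i)                   ≡⟨ Σ-suc m (f ∘ transpose i) ⟩
  Σ[1‥ m ] (f ∘ transpose i) + f (transpose i (suc m))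
    ≡⟨ cong₂ _+_ (Σ-transpose m i f 1≤i i<m) (cong f (transpose-> (s≤s i<m))) ⟩
  Σ[1‥ m ] f + f (suc m)                           ≡⟨ Σ-suc m f ⟨
  Σ[1‥ suc m ] f                                   ∎
Σ-transpose (suc (suc j)) (suc j) f _ _ | inj₂ refl = begin
  Σ[1‥ suc (suc j) ] (f ∘ τ)
    ≡⟨ trans (Σ-suc (suc j) (f ∘ τ)) (cong (_+ f (τ (suc (suc j)))) (Σ-suc j (f ∘ τ))) ⟩
  Σ[1‥ j ] (f ∘ τ) + f (τ (suc j)) + f (τ (suc (suc j)))
    ≡⟨ cong₂ _+_ (cong₂ _+_ (Σ-cong j λ k _ k≤j → cong f (transpose-< (s≤s k≤j)))
                            (cong f (transpose-i (suc j))))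
                 (cong f (transpose-suc-i (suc j))) ⟩
  Σ[1‥ j ] f + f (suc (suc j)) + f (suc j)         ≡⟨ xy∙z≈xz∙y (Σ[1‥ j ] f) _ _ ⟩
  Σ[1‥ j ] f + f (suc j) + f (suc (suc j))
    ≡⟨ sym (trans (Σ-suc (suc j) f) (cong (_+ f (suc (suc j))) (Σ-suc j f))) ⟩
  Σ[1‥ suc (suc j) ] f                             ∎
  where
  τ : ℕ → ℕ
  τ = transpose (suc j)

ΣPairs : ℕ → (ℕ → ℕ → ℕ) → ℕ
ΣPairs n G = Σ[1‥ n ] (λ d → Σ[1‥ d ∸ 1 ] (λ c → G c d))

ΣPairs-suc : ∀ n G → ΣPairs (suc n) G ≡ ΣPairs n G + Σ[1‥ n ] (λ c → G c (suc n))
ΣPairs-suc n G = Σ-suc n (λ d → Σ[1‥ d ∸ 1 ] (λ c → G c d))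

ΣPairs-cong : ∀ n {G H : ℕ → ℕ → ℕ} → (∀ c d → c < d → d ≤ n → G c d ≡ H c d)
  → ΣPairs n G ≡ ΣPairs n H
ΣPairs-cong n {G} {H} G≡H =
  Σ-cong n {λ d → Σ[1‥ d ∸ 1 ] (λ c → G c d)} {λ d → Σ[1‥ d ∸ 1 ] (λ c → H c d)} λ where
    (suc d) _ d≤n → Σ-cong d {λ c → G c (suc d)} {λ c → H c (suc d)}
                      λ c _ c≤d → G≡H c (suc d) (s≤s c≤d) d≤n

-- Transposing i and i + 1 in both coordinates permutes the pairs c < d, except
-- that the pair (i, i + 1) is read in reverse order.
ΣPairs-transpose : ∀ n i (G : ℕ → ℕ → ℕ) → 1 ≤ i → suc i ≤ n → G (suc i) i ≡ G i (suc i)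
  → ΣPairs n (λ c d → G (transpose i c) (transpose i d)) ≡ ΣPairs n G
ΣPairs-transpose (suc m) i G 1≤i i<n G-sym with m≤n⇒m<n∨m≡n (≤-pred i<n)
... | inj₁ i<m = begin
  ΣPairs (suc m) G′
    ≡⟨ ΣPairs-suc m G′ ⟩
  ΣPairs m G′ + Σ[1‥ m ] (λ c → G (transpose i c) (transpose i (suc m)))
    ≡⟨ cong₂ _+_ (ΣPairs-transpose m i G 1≤i i<m G-sym)
                 (cong (λ d → Σ[1‥ m ] (λ c → G (transpose i c) d)) (transpose-> (s≤s i<m))) ⟩
  ΣPairs m G + Σ[1‥ m ] (λ c → G (transpose i c) (suc m))
    ≡⟨ cong (ΣPairs m G +_) (Σ-transpose m i (λ c → G c (suc m)) 1≤i i<m) ⟩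
  ΣPairs m G + Σ[1‥ m ] (λ c → G c (suc m))
    ≡⟨ ΣPairs-suc m G ⟨
  ΣPairs (suc m) G ∎
  where
  G′ : ℕ → ℕ → ℕ
  G′ c d = G (transpose i c) (transpose i d)
ΣPairs-transpose (suc (suc j)) (suc j) G _ _ G-sym | inj₂ refl = begin
  ΣPairs (suc (suc j)) G′
    ≡⟨ unfold G′ ⟩
  ΣPairs j G′ + column G′ (suc j) + (column G′ (suc (suc j)) + G′ (suc j) (suc (suc j)))
    ≡⟨ cong₂ _+_ (cong₂ _+_ (ΣPairs-cong j λ c d c<d d≤j → cong₂ G (transpose-< (<-≤-trans c<d (m≤n⇒m≤1+n d≤j)))
                                                                    (transpose-< (s≤s d≤j)))
                            (column-swap (suc j) (transpose-i (suc j))))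
                 (cong₂ _+_ (column-swap (suc (suc j)) (transpose-suc-i (suc j)))
                            (trans (cong₂ G (transpose-i (suc j)) (transpose-suc-i (suc j))) G-sym)) ⟩
  ΣPairs j G + column G (suc (suc j)) + (column G (suc j) + G (suc j) (suc (suc j)))
    ≡⟨ +-assoc (ΣPairs j G) _ _ ⟩
  ΣPairs j G + (column G (suc (suc j)) + (column G (suc j) + G (suc j) (suc (suc j))))
    ≡⟨ cong (ΣPairs j G +_) (x∙yz≈y∙xz (column G (suc (suc j))) (column G (suc j)) (G (suc j) (suc (suc j)))) ⟩
  ΣPairs j G + (column G (suc j) + (column G (suc (suc j)) + G (suc j) (suc (suc j))))
    ≡⟨ +-assoc (ΣPairs j G) _ _ ⟨
  ΣPairs j G + column G (suc j) + (column G (suc (suc j)) + G (suc j) (suc (suc j)))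
    ≡⟨ unfold G ⟨
  ΣPairs (suc (suc j)) G ∎
  where
  G′ : ℕ → ℕ → ℕ
  G′ c d = G (transpose (suc j) c) (transpose (suc j) d)
  column : (ℕ → ℕ → ℕ) → ℕ → ℕ
  column H d = Σ[1‥ j ] (λ c → H c d)
  unfold : ∀ H → ΣPairs (suc (suc j)) H ≡ ΣPairs j H + column H (suc j) + (column H (suc (suc j)) + H (suc j) (suc (suc j)))
  unfold H = trans (ΣPairs-suc (suc j) H)
                   (cong₂ _+_ (ΣPairs-suc j H) (Σ-suc j (λ c → H c (suc (suc j)))))
  column-swap : ∀ d {d′} → transpose (suc j) d ≡ d′ → column G′ d ≡ column G d′
  column-swap d τd≡d′ = Σ-cong j λ c _ c≤j → cong₂ G (transpose-< (s≤s c≤j)) τd≡d′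

conj-≤-nrows : ∀ la c → conj la c ≤ nrows la
conj-≤-nrows [] c = z≤n
conj-≤-nrows (a ∷ la) c with a <ᵇ c
... | true = m≤n⇒m≤1+n (conj-≤-nrows la c)
... | false = s≤s (conj-≤-nrows la c)

conj-beyond-ncols : ∀ {la c} → IsPartition la → ncols la < c → conj la c ≡ 0
conj-beyond-ncols nil _ = refl
conj-beyond-ncols (one {a} _) a<c rewrite <ᵇ-true a<c = refl
conj-beyond-ncols (cons {a} b≤a P) a<c rewrite <ᵇ-true a<c = conj-beyond-ncols P (≤-<-trans b≤a a<c)

≤-ncols : ∀ {la c} → IsPartition la → 1 ≤ conj la c → c ≤ ncols la
≤-ncols {la} {c} P 1≤conj with c ≤? ncols la
... | yes c≤ncols = c≤ncols
... | no c≰ncols = contradiction (subst (1 ≤_) (conj-beyond-ncols P (≰⇒> c≰ncols)) 1≤conj) λ ()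

val-inCell : ∀ la σ {x c} → 1 ≤ x → 1 ≤ c → x ≤ conj la c → val la σ x c ≡ σ x c
val-inCell la σ {suc x} {suc c} _ _ x≤conj rewrite <ᵇ-false x≤conj = refl

transposeCols : ℕ → Filling → Filling
transposeCols i σ x c = σ x (transpose i c)

val-transposeCols : ∀ la σ {i} x c → 1 ≤ i → conj la i ≡ conj la (suc i)
  → val la (transposeCols i σ) x c ≡ val la σ x (transpose i c)
val-transposeCols la σ {suc i} x c _ same-height =
  cong (λ b → if b then σ x (transpose (suc i) c) else 0)
       (sym (transpose-invariant (inCell la x) (suc i) c (cong (λ h → (x ≥ᵇ 1) ∧ (h ≥ᵇ x)) same-height)))

-- D la s σ and E S la s σ unfold definitionally to
-- descents la s (val la σ s) (val la σ (suc s)) and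
-- patterns S la s (val la σ s) (val la σ (suc s)).

descentWeight : List ℕ → ℕ → (lower upper : ℕ → ℕ) → ℕ → ℕ
descentWeight la s lower upper c =
  [ (conj la c ≥ᵇ suc s) ∧ (upper c >ᵇ lower c) ] * (conj la c ∸ s)

descents : List ℕ → ℕ → (lower upper : ℕ → ℕ) → ℕ
descents la s lower upper = Σ[1‥ ncols la ] (descentWeight la s lower upper)

patternIndicator : PatSet → List ℕ → ℕ → (lower upper : ℕ → ℕ) → ℕ → ℕ → ℕ
patternIndicator S la s lower upper c d =
  [ (conj la c ≡ᵇ conj la d) ∧ (conj la c ≥ᵇ s) ∧ Q S (upper c) (upper d) (lower c) (lower d) ]

patterns : PatSet → List ℕ → ℕ → (lower upper : ℕ → ℕ) → ℕ
patterns S la s lower upper = ΣPairs (ncols la) (patternIndicator S la s lower upper)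

descents-cong : ∀ la s {lower lower′ upper upper′ : ℕ → ℕ} → lower ≗ lower′ → upper ≗ upper′
  → descents la s lower upper ≡ descents la s lower′ upper′
descents-cong la s lower≗ upper≗ = Σ-cong (ncols la) λ c _ _ →
  cong₂ (λ a b → [ (conj la c ≥ᵇ suc s) ∧ (a >ᵇ b) ] * (conj la c ∸ s)) (upper≗ c) (lower≗ c)

patterns-cong : ∀ S la s {lower lower′ upper upper′ : ℕ → ℕ} → lower ≗ lower′ → upper ≗ upper′
  → patterns S la s lower upper ≡ patterns S la s lower′ upper′
patterns-cong S la s {lower} {lower′} {upper} {upper′} lower≗ upper≗ = ΣPairs-cong (ncols la) λ c d _ _ →
  trans (cong₂ (λ z w → indicator c d z w (lower c) (lower d)) (upper≗ c) (upper≗ d))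
        (cong₂ (indicator c d (upper′ c) (upper′ d)) (lower≗ c) (lower≗ d))
  where
  indicator : ℕ → ℕ → ℕ → ℕ → ℕ → ℕ → ℕ
  indicator c d z w u v = [ (conj la c ≡ᵇ conj la d) ∧ (conj la c ≥ᵇ s) ∧ Q S z w u v ]

descents-transpose : ∀ la s {i} (lower upper : ℕ → ℕ) → 1 ≤ i → suc i ≤ ncols la
  → conj la i ≡ conj la (suc i)
  → descents la s (lower ∘ transpose i) (upper ∘ transpose i) ≡ descents la s lower upper
descents-transpose la s {i} lower upper 1≤i i<ncols same-height = begin
  descents la s (lower ∘ transpose i) (upper ∘ transpose i)
    ≡⟨ Σ-cong (ncols la) (λ c _ _ →
         cong (λ h → [ (h ≥ᵇ suc s) ∧ (upper (transpose i c) >ᵇ lower (transpose i c)) ] * (h ∸ s))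
              (sym (transpose-invariant (conj la) i c same-height))) ⟩
  Σ[1‥ ncols la ] (descentWeight la s lower upper ∘ transpose i)
    ≡⟨ Σ-transpose (ncols la) i (descentWeight la s lower upper) 1≤i i<ncols ⟩
  descents la s lower upper ∎

star-≢ : ∀ {z w} u v → z ≢ w → star z w u v ≡ false
star-≢ {z} {w} u v z≢w rewrite ≡ᵇ-false z≢w | ∧-zeroʳ (u ≥ᵇ z) | ∧-zeroʳ (v >ᵇ u) = refl

Q-swap : ∀ S {z w} u v → z ≢ w → Q S w z v u ≡ Q S z w u v
Q-swap S {z} {w} u v z≢w rewrite star-≢ u v z≢w | star-≢ v u (≢-sym z≢w) = ∨-comm (six S w z v u) (six S z w u v)

patterns-transpose : ∀ S la s {i} (lower upper : ℕ → ℕ) → 1 ≤ i → suc i ≤ ncols la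
  → conj la i ≡ conj la (suc i) → upper i ≢ upper (suc i)
  → patterns S la s (lower ∘ transpose i) (upper ∘ transpose i) ≡ patterns S la s lower upper
patterns-transpose S la s {i} lower upper 1≤i i<ncols same-height upper-differs = begin
  patterns S la s (lower ∘ transpose i) (upper ∘ transpose i)
    ≡⟨ ΣPairs-cong (ncols la) (λ c d _ _ → cong₂ (λ h h′ → [ (h ≡ᵇ h′) ∧ (h ≥ᵇ s) ∧ Q′ c d ])
                                                  (sym (transpose-invariant (conj la) i c same-height))
                                                  (sym (transpose-invariant (conj la) i d same-height))) ⟩
  ΣPairs (ncols la) (λ c d → indicator (transpose i c) (transpose i d))
    ≡⟨ ΣPairs-transpose (ncols la) i indicator 1≤i i<ncols indicator-sym ⟩
  patterns S la s lower upper ∎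
  where
  indicator : ℕ → ℕ → ℕ
  indicator = patternIndicator S la s lower upper
  Q′ : ℕ → ℕ → Bool
  Q′ c d = Q S (upper (transpose i c)) (upper (transpose i d)) (lower (transpose i c)) (lower (transpose i d))
  indicator-sym : indicator (suc i) i ≡ indicator i (suc i)
  indicator-sym rewrite same-height =
    cong (λ q → [ (conj la (suc i) ≡ᵇ conj la (suc i)) ∧ (conj la (suc i) ≥ᵇ s) ∧ q ])
         (Q-swap S (lower i) (lower (suc i)) upper-differs)

val-cong-row : ∀ la {σ σ′ : Filling} x → σ x ≗ σ′ x → val la σ x ≗ val la σ′ x
val-cong-row la x row c = cong (if inCell la x c then_else 0) (row c)

D-E-cong-rows : ∀ S la s (σ σ′ : Filling) → σ s ≗ σ′ s → σ (suc s) ≗ σ′ (suc s)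
  → (D la s σ ≡ D la s σ′) × (E S la s σ ≡ E S la s σ′)
D-E-cong-rows S la s σ σ′ row₀ row₁ =
  descents-cong la s (val-cong-row la {σ} {σ′} s row₀) (val-cong-row la {σ} {σ′} (suc s) row₁) ,
  patterns-cong S la s (val-cong-row la {σ} {σ′} s row₀) (val-cong-row la {σ} {σ′} (suc s) row₁)

D-E-transposeCols : ∀ S la s {i} (σ : Filling) → 1 ≤ i → suc i ≤ ncols la
  → conj la i ≡ conj la (suc i) → val la σ (suc s) i ≢ val la σ (suc s) (suc i)
  → (D la s σ ≡ D la s (transposeCols i σ)) × (E S la s σ ≡ E S la s (transposeCols i σ))
D-E-transposeCols S la s {i} σ 1≤i i<ncols same-height differs =
  sym (trans (descents-cong la s (row s) (row (suc s)))
             (descents-transpose la s (val la σ s) (val la σ (suc s)) 1≤i i<ncols same-height)) ,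
  sym (trans (patterns-cong S la s (row s) (row (suc s)))
             (patterns-transpose S la s (val la σ s) (val la σ (suc s)) 1≤i i<ncols same-height differs))
  where
  row : ∀ x → val la (transposeCols i σ) x ≗ val la σ x ∘ transpose i
  row x c = val-transposeCols la σ x c 1≤i same-height

findK-≤ : ∀ σ i r → 1 ≤ r → findK σ i r ≤ r
findK-≤ σ i (suc r) _ with σ (suc r) i ≡ᵇ σ (suc r) (suc i)
... | true = ≤-refl
findK-≤ σ i (suc zero) _ | false = ≤-refl
findK-≤ σ i (suc (suc r)) _ | false = m≤n⇒m≤1+n (findK-≤ σ i (suc r) (s≤s z≤n))

findK-agrees : ∀ σ i r → 2 ≤ findK σ i r → σ (findK σ i r) i ≡ σ (findK σ i r) (suc i)
findK-agrees σ i zero (s≤s ())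
findK-agrees σ i (suc r) 2≤k with σ (suc r) i ≡ᵇ σ (suc r) (suc i) in eq
... | true = ≡ᵇ⇒≡ _ _ (subst T (sym eq) _)
... | false = findK-agrees σ i r 2≤k

findK-maximal : ∀ σ i r {x} → findK σ i r < x → x ≤ r → σ x i ≢ σ x (suc i)
findK-maximal σ i zero (s≤s _) ()
findK-maximal σ i (suc r) {x} k<x x≤r with σ (suc r) i ≡ᵇ σ (suc r) (suc i) in eq
... | true = ⊥-elim (<⇒≱ k<x x≤r)
... | false with m≤n⇒m<n∨m≡n x≤r
...   | inj₁ x<r = findK-maximal σ i r k<x (≤-pred x<r)
...   | inj₂ refl = λ σ-agrees → subst T eq (≡⇒≡ᵇ _ _ σ-agrees)

δ-below : ∀ i r σ {x} → x < findK σ i r → δ i r σ x ≗ σ x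
δ-below i r σ x<k c rewrite <ᵇ-true x<k = refl

δ-above : ∀ i r σ {x} → r < x → δ i r σ x ≗ σ x
δ-above i r σ {x} r<x c rewrite <ᵇ-true r<x | ∧-zeroʳ (not (x <ᵇ findK σ i r)) = refl

δ-inside : ∀ i r σ {x} → findK σ i r ≤ x → x ≤ r → δ i r σ x ≗ transposeCols i σ x
δ-inside i r σ {x} k≤x x≤r c rewrite <ᵇ-false k≤x | <ᵇ-false x≤r =
  sym (trans (if-float (σ x) (c ≡ᵇ i)) (if-cong-else (c ≡ᵇ i) (if-float (σ x) (c ≡ᵇ suc i))))

δ-fixes-row-findK : ∀ i r σ → 1 ≤ r → 2 ≤ findK σ i r → δ i r σ (findK σ i r) ≗ σ (findK σ i r)
δ-fixes-row-findK i r σ 1≤r 2≤k c = begin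
  δ i r σ k c          ≡⟨ δ-inside i r σ ≤-refl (findK-≤ σ i r 1≤r) c ⟩
  σ k (transpose i c)  ≡⟨ transpose-invariant (σ k) i c (findK-agrees σ i r 2≤k) ⟩
  σ k c                ∎
  where
  k : ℕ
  k = findK σ i r

δ-preserves-D-E : ∀ S la {i} r σ → 1 ≤ i → suc i ≤ ncols la → conj la i ≡ conj la (suc i)
  → 1 ≤ r → r ≤ conj la i
  → ∀ s → 1 ≤ s → s ≢ r → (D la s σ ≡ D la s (δ i r σ)) × (E S la s σ ≡ E S la s (δ i r σ))
δ-preserves-D-E S la {i} r σ 1≤i i<ncols same-height 1≤r r≤h s 1≤s s≢r with <-cmp (suc s) (findK σ i r)
... | tri< s+1<k _ _ =
  D-E-cong-rows S la s σ (δ i r σ)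
    (sym ∘ δ-below i r σ (<-trans (n<1+n s) s+1<k)) (sym ∘ δ-below i r σ s+1<k)
... | tri≈ _ s+1≡k _ =
  D-E-cong-rows S la s σ (δ i r σ) (sym ∘ δ-below i r σ (subst (s <_) s+1≡k (n<1+n s)))
    (subst (λ x → σ x ≗ δ i r σ x) (sym s+1≡k)
           (sym ∘ δ-fixes-row-findK i r σ 1≤r (subst (2 ≤_) s+1≡k (s≤s 1≤s))))
... | tri> _ _ k≤s with <-cmp s r
...   | tri≈ _ s≡r _ = ⊥-elim (s≢r s≡r)
...   | tri> _ _ r<s =
  D-E-cong-rows S la s σ (δ i r σ) (sym ∘ δ-above i r σ r<s) (sym ∘ δ-above i r σ (m<n⇒m<1+n r<s))
...   | tri< s<r _ _ =
  zip′ trans trans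
    (D-E-transposeCols S la s σ 1≤i i<ncols same-height differs)
    (D-E-cong-rows S la s (transposeCols i σ) (δ i r σ)
       (sym ∘ δ-inside i r σ (≤-pred k≤s) (<⇒≤ s<r)) (sym ∘ δ-inside i r σ (<⇒≤ k≤s) s<r))
  where
  s+1≤h : suc s ≤ conj la i
  s+1≤h = ≤-trans s<r r≤h
  differs : val la σ (suc s) i ≢ val la σ (suc s) (suc i)
  differs rewrite val-inCell la σ (s≤s z≤n) 1≤i s+1≤h
                | val-inCell la σ (s≤s z≤n) (s≤s z≤n) (subst (suc s ≤_) same-height s+1≤h)
    = findK-maximal σ i r k≤s s<r

lemma4p4 : (la : List ℕ) → IsPartition la → (i : ℕ) → 1 ≤ i → (h : ℕ)
    → conj la i ≡ h → conj la (suc i) ≡ h → (r : ℕ) → 1 ≤ r → r ≤ h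
    → (σ : Filling) → IsFilling la σ → (S : PatSet)
    → (maj la σ + D la r (δ i r σ) ≡ maj la (δ i r σ) + D la r σ)
      × (η S la σ + E S la r (δ i r σ) ≡ η S la (δ i r σ) + E S la r σ)
      × ((s : ℕ) → 1 ≤ s → s ≢ r
         → (D la s σ ≡ D la s (δ i r σ)) × (E S la s σ ≡ E S la s (δ i r σ)))
lemma4p4 la P i 1≤i h refl same-height r 1≤r r≤h σ _ S =
  Σ-agree-except (nrows la) r (λ s → D la s σ) (λ s → D la s σ′) 1≤r r≤nrows
    (λ s 1≤s s≢r → proj₁ (off-r s 1≤s s≢r)) ,
  Σ-agree-except (nrows la) r (λ s → E S la s σ) (λ s → E S la s σ′) 1≤r r≤nrows
    (λ s 1≤s s≢r → proj₂ (off-r s 1≤s s≢r)) ,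
  off-r
  where
  σ′ : Filling
  σ′ = δ i r σ
  r≤nrows : r ≤ nrows la
  r≤nrows = ≤-trans r≤h (conj-≤-nrows la i)
  i<ncols : suc i ≤ ncols la
  i<ncols = ≤-ncols P (subst (1 ≤_) (sym same-height) (≤-trans 1≤r r≤h))
  off-r : ∀ s → 1 ≤ s → s ≢ r → (D la s σ ≡ D la s σ′) × (E S la s σ ≡ E S la s σ′)
  off-r = δ-preserves-D-E S la r σ 1≤i i<ncols (sym same-height) 1≤r r≤h
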